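{- Let $\Gamma$ be a finite abelian group of order $n\ge4$, $A=-A\subseteq\Gamma\setminus\{0\}$, $G=G(\Gamma,A)$ the Cayley graph, $\chi$ a nontrivial character of $\Gamma$ with $m=|\chi(\Gamma)|$, and $\rho:\Gamma\to\mathbb{Z}/m\mathbb{Z}$ the homomorphism with $\chi(\gamma)=e^{2\pi i\rho(\gamma)/m}$. Suppose $0<\delta\le1/3$ and $d$ is an integer with $d\ge\delta m/2$. If $G$ satisfies $\mathrm{DISC}(\delta)$, then $$|A\cap\rho^{ -1}([0,d))|\le4\frac dm|A|.$$
   Context: The Cayley graph $G(\Gamma,A)$ has vertex set $\Gamma$, with $\gamma,\gamma'$ adjacent iff $\gamma'-\gamma\in A$. A character is a homomorphism $\Gamma\to S^1\subset\mathbb{C}$. Write $x\sim_\delta y$ if $(1-\delta)y\le x\le(1+\delta)y$. $\rho^{ -1}([0,d))$ is the set of $\gamma$ with $\rho(\gamma)\equiv f\pmod m$ for some integer $0\le f<d$. Property $\mathrm{DISC}(\delta)$: for all $U\subseteq\Gamma$ with $|U|\ge\delta n$, the number of edges of $G$ inside $U$ is $\sim_\delta e(G)\binom{|U|}2/\binom n2$.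
   Formalization: The parameter δ in 0<δ≤1/3, and hence in the property DISC(δ), is taken to be rational. -}

module Defs where

open import Data.Bool using (Bool; true; false; if_then_else_; _∧_)
open import Data.Nat as ℕ using (ℕ; zero; suc; NonZero)
open import Data.Nat.Combinatorics using (_C_)
open import Data.Nat.DivMod using (_mod_)
open import Data.Fin using (Fin; toℕ)
open import Data.Integer using (+_)
open import Data.Rational using (ℚ; _/_; _≤_; _*_; _-_; _+_; 1ℚ)
open import Data.Product using (_×_)
open import Relation.Binary.PropositionalEquality using (_≡_)

ℕ→ℚ : ℕ → ℚ
ℕ→ℚ k = + k / 1

-- a / b as a rational (only used with b > 0; the b = 0 case is a dummy value)
ratio : ℕ → ℕ → ℚ
ratio a zero = + 0 / 1
ratio a (suc b) = + a / suc b

sumFin : ∀ {n} → (Fin n → ℕ) → ℕ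
sumFin {zero} f = 0
sumFin {suc n} f = f Fin.zero ℕ.+ sumFin (λ i → f (Fin.suc i))

count : ∀ {n} → (Fin n → Bool) → ℕ
count P = sumFin (λ i → if P i then 1 else 0)

_∼[_]_ : ℚ → ℚ → ℚ → Set
x ∼[ δ ] y = ((1ℚ - δ) * y ≤ x) × (x ≤ (1ℚ + δ) * y)

-- Cayley graph G(Γ, A) on the group (Fin n, _⊕_, ⊖_) with connection set A ⊆ Γ
-- (given by its indicator function).  x, y adjacent iff y - x ∈ A.
module Cayley {n : ℕ} (_⊕_ : Fin n → Fin n → Fin n) (⊖_ : Fin n → Fin n) (A : Fin n → Bool) where

  orderedPairs : (Fin n → Bool) → ℕ
  orderedPairs U = sumFin (λ x → if U x then count (λ y → U y ∧ A (y ⊕ (⊖ x))) else 0)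

  -- number of edges of G inside U (each edge {x,y} is counted twice as an ordered pair,
  -- there are no loops since 0 ∉ A, and adjacency is symmetric since A = -A)
  edgesIn : (Fin n → Bool) → ℚ
  edgesIn U = ratio (orderedPairs U) 2

  eG : ℚ
  eG = edgesIn (λ _ → true)

  DISC : ℚ → Set
  DISC δ = ∀ (U : Fin n → Bool) → δ * ℕ→ℚ n ≤ ℕ→ℚ (count U) →
           edgesIn U ∼[ δ ] (eG * ratio (count U C 2) (n C 2))

IsHomToZmod : ∀ {n} (_⊕_ : Fin n → Fin n → Fin n) (m : ℕ) .{{_ : NonZero m}} → (Fin n → Fin m) → Set
IsHomToZmod _⊕_ m ρ = ∀ x y → ρ (x ⊕ y) ≡ (toℕ (ρ x) ℕ.+ toℕ (ρ y)) mod m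

module Submission where

-- Write r = toℕ ∘ ρ : Γ → [0, m), let K be the size of the kernel of ρ, and
-- assume 4d < m (otherwise the bound is trivial since |A ∩ ρ⁻¹[0,d)| ≤ |A|).
-- Consider the window U = ρ⁻¹[0, 2d), so n = mK and |U| = 2dK ≥ δn.
--   * Lower bound.  Writing orderedPairs U = Σ_{a ∈ A} #{x ∈ U : a + x ∈ U},
--     every a ∈ A with r a < d contributes |U|, where a nonzero residue is
--     shared between a and -a (whose residue lies in (m-d, m), so never in
--     [0, d)).  Hence |A ∩ ρ⁻¹[0,d)| · |U| ≤ orderedPairs U.
--   * Upper bound.  DISC(δ) applied to U, with δ ≤ 1, gives
--     orderedPairs U · C(n,2) ≤ 2 · n|A| · C(|U|,2).
-- Comparing the two bounds gives |A ∩ ρ⁻¹[0,d)| · n ≤ 2|A| · |U|, that is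
-- m · |A ∩ ρ⁻¹[0,d)| ≤ 4d|A| after cancelling K.

open import Defs
open import Data.Bool using (Bool; true; false; _∧_; not; T; if_then_else_)
open import Data.Bool.Properties using (T-≡; ∧-zeroʳ; ∧-idem)
open import Data.Nat using (ℕ; zero; suc; _≤_; _<_; _*_; _+_; _∸_; _<ᵇ_; _≡ᵇ_; NonZero; z≤n; s≤s; z<s; _<?_; _≤?_)
import Data.Nat as ℕ
import Data.Nat.Properties as ℕP
open import Data.Nat.DivMod using (_%_; m<n⇒m%n≡m; [m+n]%n≡m%n)
open import Data.Nat.Combinatorics using (_C_; nCk+nC[k+1]≡[n+1]C[k+1]; nC1≡n)
open import Data.Nat.Tactic.RingSolver using (solve-∀)
open import Data.Fin using (Fin; toℕ; fromℕ<)
import Data.Fin.Properties as FinP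
open import Data.Fin.Permutation using (permutation)
open import Data.Integer using (+_)
import Data.Integer as ℤ
import Data.Integer.Properties as ℤP
open import Data.Rational as ℚ using (ℚ; 0ℚ; 1ℚ; ½; _/_; toℚᵘ)
import Data.Rational.Properties as ℚP
open import Data.Rational.Unnormalised using (mkℚᵘ; *≤*; *≡*) renaming (_≃_ to _≃ᵘ_; _*_ to _ℚᵘ*_)
import Data.Rational.Unnormalised.Properties as ℚᵘP
open import Data.Product using (∃; _×_; _,_; proj₁; proj₂)
open import Data.Sum using (_⊎_; inj₁; inj₂)
open import Function using (_∘_; Equivalence)
open import Data.Empty using (⊥-elim)
open import Relation.Nullary using (yes; no)
open import Relation.Nullary.Decidable using (toWitness)
open import Relation.Binary.PropositionalEquality
open import Algebra.Bundles using (Group)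
open import Level using (0ℓ)
open import Algebra.Structures using (IsAbelianGroup; IsGroup)
import Algebra.Properties.Group as GroupProperties
import Algebra.Properties.CommutativeMonoid.Sum ℕP.+-0-commutativeMonoid as Σ
import Algebra.Properties.Semiring.Sum ℕP.+-*-semiring as Σ*

-- sumFin is the library's finite sum, so its algebra can be imported.
sumFin≡sum : ∀ {n} (f : Fin n → ℕ) → sumFin f ≡ Σ.sum f
sumFin≡sum {zero}  f = refl
sumFin≡sum {suc n} f = cong (_+_ (f Fin.zero)) (sumFin≡sum (f ∘ Fin.suc))

sumFin-from-sum : ∀ {m n} (f : Fin m → ℕ) (g : Fin n → ℕ) → Σ.sum f ≡ Σ.sum g → sumFin f ≡ sumFin g
sumFin-from-sum f g eq = trans (sumFin≡sum f) (trans eq (sym (sumFin≡sum g)))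

sumFin-cong : ∀ {n} {f g : Fin n → ℕ} → (∀ i → f i ≡ g i) → sumFin f ≡ sumFin g
sumFin-cong {f = f} {g} f≗g = sumFin-from-sum f g (Σ.sum-cong-≗ f≗g)

sumFin-mono : ∀ {n} {f g : Fin n → ℕ} → (∀ i → f i ≤ g i) → sumFin f ≤ sumFin g
sumFin-mono {zero}  f≤g = z≤n
sumFin-mono {suc n} f≤g = ℕP.+-mono-≤ (f≤g Fin.zero) (sumFin-mono (f≤g ∘ Fin.suc))

sumFin-+ : ∀ {n} (f g : Fin n → ℕ) → sumFin (λ i → f i + g i) ≡ sumFin f + sumFin g
sumFin-+ f g = begin
  sumFin (λ i → f i + g i)  ≡⟨ sumFin≡sum (λ i → f i + g i) ⟩
  Σ.sum (λ i → f i + g i)   ≡⟨ Σ.∑-distrib-+ f g ⟩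
  Σ.sum f + Σ.sum g         ≡⟨ sym (cong₂ _+_ (sumFin≡sum f) (sumFin≡sum g)) ⟩
  sumFin f + sumFin g       ∎
  where open ≡-Reasoning

sumFin-*ˡ : ∀ {n} (c : ℕ) (f : Fin n → ℕ) → sumFin (λ i → c * f i) ≡ c * sumFin f
sumFin-*ˡ c f = begin
  sumFin (λ i → c * f i)  ≡⟨ sumFin≡sum (λ i → c * f i) ⟩
  Σ.sum (λ i → c * f i)   ≡⟨ sym (Σ*.*-distribˡ-sum c f) ⟩
  c * Σ.sum f             ≡⟨ cong (c *_) (sym (sumFin≡sum f)) ⟩
  c * sumFin f            ∎
  where open ≡-Reasoning

sumFin-*ʳ : ∀ {n} (c : ℕ) (f : Fin n → ℕ) → sumFin (λ i → f i * c) ≡ sumFin f * c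
sumFin-*ʳ c f = begin
  sumFin (λ i → f i * c)  ≡⟨ sumFin≡sum (λ i → f i * c) ⟩
  Σ.sum (λ i → f i * c)   ≡⟨ sym (Σ*.*-distribʳ-sum c f) ⟩
  Σ.sum f * c             ≡⟨ cong (_* c) (sym (sumFin≡sum f)) ⟩
  sumFin f * c            ∎
  where open ≡-Reasoning

sumFin-const : ∀ {n} (c : ℕ) → sumFin {n} (λ _ → c) ≡ n * c
sumFin-const {zero}  c = refl
sumFin-const {suc n} c = cong (_+_ c) (sumFin-const {n} c)

sumFin-swap : ∀ {m n} (f : Fin m → Fin n → ℕ) →
  sumFin (λ i → sumFin (f i)) ≡ sumFin (λ j → sumFin (λ i → f i j))
sumFin-swap f = begin
  sumFin (λ i → sumFin (f i))                 ≡⟨ sumFin-cong (λ i → sumFin≡sum (f i)) ⟩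
  sumFin (λ i → Σ.sum (f i))
    ≡⟨ sumFin-from-sum (λ i → Σ.sum (f i)) (λ j → Σ.sum (λ i → f i j)) (Σ.∑-comm f) ⟩
  sumFin (λ j → Σ.sum (λ i → f i j))          ≡⟨ sumFin-cong (λ j → sym (sumFin≡sum (λ i → f i j))) ⟩
  sumFin (λ j → sumFin (λ i → f i j))         ∎
  where open ≡-Reasoning

sumFin-bijection : ∀ {n} (f : Fin n → ℕ) (σ τ : Fin n → Fin n) →
  (∀ x → σ (τ x) ≡ x) → (∀ x → τ (σ x) ≡ x) → sumFin (f ∘ σ) ≡ sumFin f
sumFin-bijection f σ τ στ τσ =
  sumFin-from-sum (f ∘ σ) f (sym (Σ.sum-permute f (permutation σ τ στ τσ)))

ι : Bool → ℕ
ι b = if b then 1 else 0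

T⇒≡true : ∀ {b} → T b → b ≡ true
T⇒≡true = Equivalence.to T-≡

≡true⇒T : ∀ {b} → b ≡ true → T b
≡true⇒T = Equivalence.from T-≡

≢ᵇ0⇒>0 : ∀ {k} → (k ≡ᵇ 0) ≡ false → 0 < k
≢ᵇ0⇒>0 {suc k} _ = z<s

ι≤1 : ∀ b → ι b ≤ 1
ι≤1 true  = s≤s z≤n
ι≤1 false = z≤n

ι-if : ∀ b k → (if b then k else 0) ≡ ι b * k
ι-if true  k = sym (ℕP.+-identityʳ k)
ι-if false k = refl

-- The identity used to exchange the roles of a point and a difference
-- when counting ordered pairs of a Cayley graph.
ι-exchange : ∀ p q s → ι p * ι (q ∧ s) ≡ ι s * ι (p ∧ q)
ι-exchange true  true  true  = refl
ι-exchange true  true  false = refl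
ι-exchange true  false true  = refl
ι-exchange true  false false = refl
ι-exchange false true  true  = refl
ι-exchange false true  false = refl
ι-exchange false false true  = refl
ι-exchange false false false = refl

ι-∧-* : ∀ p q k → ι (p ∧ q) * k ≡ ι p * (ι q * k)
ι-∧-* true  q k = sym (ℕP.*-identityˡ (ι q * k))
ι-∧-* false q k = refl

ι-<ᵇ : ∀ {v k} → v < k → ι (v <ᵇ k) ≡ 1
ι-<ᵇ {v} {k} v<k = cong ι (T⇒≡true (ℕP.<⇒<ᵇ v<k))

count-∧≤ : ∀ {n} (P Q : Fin n → Bool) → count (λ i → P i ∧ Q i) ≤ count P
count-∧≤ P Q = sumFin-mono (λ i → lemma (P i) (Q i))
  where
  lemma : ∀ p q → ι (p ∧ q) ≤ ι p
  lemma true  q = ι≤1 q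
  lemma false q = z≤n

count-∧-false : ∀ {n} (P : Fin n → Bool) → count (λ i → P i ∧ false) ≡ 0
count-∧-false {n} P =
  trans (sumFin-cong (λ i → cong ι (∧-zeroʳ (P i)))) (trans (sumFin-const {n} 0) (ℕP.*-zeroʳ n))

ι-<ᵇ-suc : ∀ v k → ι (v <ᵇ suc k) ≡ ι (v <ᵇ k) + ι (v ≡ᵇ k)
ι-<ᵇ-suc zero    zero    = refl
ι-<ᵇ-suc zero    (suc k) = refl
ι-<ᵇ-suc (suc v) zero    = refl
ι-<ᵇ-suc (suc v) (suc k) = ι-<ᵇ-suc v k


%-sum : ∀ {m} .{{_ : NonZero m}} x y → x < m → y < m →
  (x + y) % m ≡ x + y ⊎ (m ≤ x + y × (x + y) % m ≡ x + y ∸ m)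
%-sum {m} x y x<m y<m with x + y <? m
... | yes x+y<m = inj₁ (m<n⇒m%n≡m x+y<m)
... | no  x+y≮m = inj₂ (m≤x+y , reduce)
  where
  m≤x+y : m ≤ x + y
  m≤x+y = ℕP.≮⇒≥ x+y≮m
  reduce : (x + y) % m ≡ x + y ∸ m
  reduce = begin
    (x + y) % m          ≡⟨ cong (_% m) (sym (ℕP.m∸n+n≡m m≤x+y)) ⟩
    (x + y ∸ m + m) % m  ≡⟨ [m+n]%n≡m%n (x + y ∸ m) m ⟩
    (x + y ∸ m) % m      ≡⟨ m<n⇒m%n≡m (ℕP.m<n+o⇒m∸n<o (x + y) m (ℕP.+-mono-< x<m y<m)) ⟩
    x + y ∸ m            ∎
    where open ≡-Reasoning

%-cancel : ∀ {m} .{{_ : NonZero m}} {x y} → x < m → y < m → (x + y) % m ≡ y → x ≡ 0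
%-cancel {m} {x} {y} x<m y<m eq with %-sum x y x<m y<m
... | inj₁ e = ℕP.+-cancelʳ-≡ y x 0 (trans (sym e) eq)
... | inj₂ (m≤x+y , e) = ⊥-elim (ℕP.<-irrefl (ℕP.+-cancelʳ-≡ y x m x+y≡m+y) x<m)
  where
  x+y≡m+y : x + y ≡ m + y
  x+y≡m+y = trans (sym (ℕP.m∸n+n≡m m≤x+y)) (trans (cong (_+ m) (trans (sym e) eq)) (ℕP.+-comm y m))

%-complement : ∀ {m} .{{_ : NonZero m}} {x y} → 0 < x → x < m → y < m → (x + y) % m ≡ 0 → y ≡ m ∸ x
%-complement {m} {x} {y} 0<x x<m y<m eq with %-sum x y x<m y<m
... | inj₁ e = ⊥-elim (ℕP.<-irrefl (sym (ℕP.m+n≡0⇒m≡0 x (trans (sym e) eq))) 0<x)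
... | inj₂ (m≤x+y , e) = trans (sym (ℕP.m+n∸m≡n x y)) (cong (_∸ x) x+y≡m)
  where
  x+y≡m : x + y ≡ m
  x+y≡m = ℕP.≤-antisym (ℕP.m∸n≡0⇒m≤n (trans (sym e) eq)) m≤x+y

%-window : ∀ {m} .{{_ : NonZero m}} {x y d} → x < d → d + d ≤ m → y < d + d →
  (x + y) % m < d + d ⊎ ((m ∸ x) + y) % m < d + d
%-window {m} {x} {y} {d} x<d 2d≤m y<2d with y <? x
... | yes y<x = inj₁ (subst (_< d + d) (sym (m<n⇒m%n≡m (ℕP.<-≤-trans x+y<2d 2d≤m))) x+y<2d)
  where
  x+y<2d : x + y < d + d
  x+y<2d = ℕP.+-mono-< x<d (ℕP.<-trans y<x x<d)
... | no  y≮x = inj₂ (subst (_< d + d) (sym down) (ℕP.≤-<-trans (ℕP.m∸n≤m y x) y<2d))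
  where
  x≤y : x ≤ y
  x≤y = ℕP.≮⇒≥ y≮x
  y<m : y < m
  y<m = ℕP.<-≤-trans y<2d 2d≤m
  rearrange : (m ∸ x) + y ≡ (y ∸ x) + m
  rearrange = begin
    (m ∸ x) + y              ≡⟨ cong (_+_ (m ∸ x)) (sym (ℕP.m∸n+n≡m x≤y)) ⟩
    (m ∸ x) + ((y ∸ x) + x)  ≡⟨ exchange (m ∸ x) (y ∸ x) x ⟩
    (y ∸ x) + ((m ∸ x) + x)  ≡⟨ cong (_+_ (y ∸ x)) (ℕP.m∸n+n≡m (ℕP.≤-trans x≤y (ℕP.<⇒≤ y<m))) ⟩
    (y ∸ x) + m              ∎
    where
    open ≡-Reasoning
    exchange : ∀ a b c → a + (b + c) ≡ b + (a + c)
    exchange = solve-∀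
  down : ((m ∸ x) + y) % m ≡ y ∸ x
  down = begin
    ((m ∸ x) + y) % m  ≡⟨ cong (_% m) rearrange ⟩
    ((y ∸ x) + m) % m  ≡⟨ [m+n]%n≡m%n (y ∸ x) m ⟩
    (y ∸ x) % m        ≡⟨ m<n⇒m%n≡m (ℕP.≤-<-trans (ℕP.m∸n≤m y x) y<m) ⟩
    y ∸ x              ∎
    where open ≡-Reasoning

%-shift-≡ᵇ : ∀ {m} .{{_ : NonZero m}} {v s} → v < m → s < m → ((v + s) % m ≡ᵇ s) ≡ (v ≡ᵇ 0)
%-shift-≡ᵇ {v = zero} {s} _ s<m =
  trans (cong (_≡ᵇ s) (m<n⇒m%n≡m s<m)) (T⇒≡true (ℕP.≡⇒≡ᵇ s s refl))
%-shift-≡ᵇ {m} {v = suc v} {s} v<m s<m with (suc v + s) % m ≡ᵇ s in fixed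
... | false = refl
... | true with () ← %-cancel v<m s<m (ℕP.≡ᵇ⇒≡ _ _ (≡true⇒T fixed))

-- The fraction a / (1 + b); note ratio a (suc b) = frac a b and ℕ→ℚ a = frac a 0.
frac : ℕ → ℕ → ℚ
frac a b = + a / suc b

toℚᵘ-frac : ∀ a b → toℚᵘ (frac a b) ≃ᵘ mkℚᵘ (+ a) b
toℚᵘ-frac a b = ℚP.toℚᵘ-fromℚᵘ (mkℚᵘ (+ a) b)

frac-nonNeg : ∀ a b → ℚ.NonNegative (frac a b)
frac-nonNeg a b = ℚP.normalize-nonNeg a (suc b)

frac-≤⇒ : ∀ a b c d → frac a b ℚ.≤ frac c d → a * suc d ≤ c * suc b
frac-≤⇒ a b c d ab≤cd
  with ℚᵘP.≤-respʳ-≃ (toℚᵘ-frac c d) (ℚᵘP.≤-respˡ-≃ (toℚᵘ-frac a b) (ℚP.toℚᵘ-mono-≤ ab≤cd))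
... | *≤* cross = ℤP.drop‿+≤+ (subst₂ ℤ._≤_ (sym (ℤP.pos-* a (suc d))) (sym (ℤP.pos-* c (suc b))) cross)

frac-cross : ∀ a b c d → a * suc d ≡ c * suc b → frac a b ≡ frac c d
frac-cross a b c d cross = ℚP.toℚᵘ-injective
  (ℚᵘP.≃-trans (toℚᵘ-frac a b) (ℚᵘP.≃-trans unnormalised (ℚᵘP.≃-sym (toℚᵘ-frac c d))))
  where
  unnormalised : mkℚᵘ (+ a) b ≃ᵘ mkℚᵘ (+ c) d
  unnormalised = *≡* (trans (sym (ℤP.pos-* a (suc d))) (trans (cong +_ cross) (ℤP.pos-* c (suc b))))

frac-* : ∀ a b c d → frac a b ℚ.* frac c d ≡ frac (a * c) (d + b * suc d)
frac-* a b c d = ℚP.toℚᵘ-injective (begin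
  toℚᵘ (frac a b ℚ.* frac c d)               ≈⟨ ℚP.toℚᵘ-homo-* (frac a b) (frac c d) ⟩
  toℚᵘ (frac a b) ℚᵘ* toℚᵘ (frac c d)        ≈⟨ ℚᵘP.*-cong (toℚᵘ-frac a b) (toℚᵘ-frac c d) ⟩
  mkℚᵘ (+ a ℤ.* + c) (d + b * suc d)          ≡⟨ cong (λ z → mkℚᵘ z (d + b * suc d)) (sym (ℤP.pos-* a c)) ⟩
  mkℚᵘ (+ (a * c)) (d + b * suc d)            ≈⟨ ℚᵘP.≃-sym (toℚᵘ-frac (a * c) (d + b * suc d)) ⟩
  toℚᵘ (frac (a * c) (d + b * suc d))         ∎)
  where open import Relation.Binary.Reasoning.Setoid ℚᵘP.≃-setoid

-- The hypothesis δ ≤ 1/3 is only used through δ ≤ 1.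
⅓≤1 : (+ 1 / 3) ℚ.≤ 1ℚ
⅓≤1 = toWitness {a? = (+ 1 / 3) ℚP.≤? 1ℚ} _

-- Scaling δm/2 ≤ d by 2K: the window of 2dK points is large in the DISC sense.
window-large : ∀ (δ : ℚ) m d K → δ ℚ.* ℕ→ℚ m ℚ.* ½ ℚ.≤ ℕ→ℚ d →
  δ ℚ.* ℕ→ℚ (m * K) ℚ.≤ ℕ→ℚ ((d + d) * K)
window-large δ m d K δm/2≤d = subst₂ ℚ._≤_ left right
  (ℚP.*-monoʳ-≤-nonNeg (frac (2 * K) 0) {{frac-nonNeg (2 * K) 0}} δm/2≤d)
  where
  open ≡-Reasoning
  ½·2K≡K : ½ ℚ.* frac (2 * K) 0 ≡ frac K 0
  ½·2K≡K = trans (frac-* 1 1 (2 * K) 0) (frac-cross (1 * (2 * K)) (0 + 1 * 1) K 0 (half-of-double K))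
    where
    half-of-double : ∀ K → 1 * (2 * K) * 1 ≡ K * 2
    half-of-double = solve-∀
  left : δ ℚ.* ℕ→ℚ m ℚ.* ½ ℚ.* frac (2 * K) 0 ≡ δ ℚ.* ℕ→ℚ (m * K)
  left = begin
    δ ℚ.* frac m 0 ℚ.* ½ ℚ.* frac (2 * K) 0    ≡⟨ ℚP.*-assoc (δ ℚ.* frac m 0) ½ (frac (2 * K) 0) ⟩
    δ ℚ.* frac m 0 ℚ.* (½ ℚ.* frac (2 * K) 0)  ≡⟨ cong (δ ℚ.* frac m 0 ℚ.*_) ½·2K≡K ⟩
    δ ℚ.* frac m 0 ℚ.* frac K 0                ≡⟨ ℚP.*-assoc δ (frac m 0) (frac K 0) ⟩
    δ ℚ.* (frac m 0 ℚ.* frac K 0)              ≡⟨ cong (δ ℚ.*_) (frac-* m 0 K 0) ⟩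
    δ ℚ.* frac (m * K) 0                       ∎
  right : ℕ→ℚ d ℚ.* frac (2 * K) 0 ≡ ℕ→ℚ ((d + d) * K)
  right = trans (frac-* d 0 (2 * K) 0) (cong (λ z → frac z 0) (d·2K d K))
    where
    d·2K : ∀ d K → d * (2 * K) ≡ (d + d) * K
    d·2K = solve-∀

halves-bound : ∀ (δ : ℚ) → δ ℚ.≤ 1ℚ → ∀ P E c N → 0 < N →
  ratio P 2 ℚ.≤ (1ℚ ℚ.+ δ) ℚ.* (ratio E 2 ℚ.* ratio c N) → P * N ≤ 2 * (E * c)
halves-bound δ δ≤1 P E c (suc N) _ upper =
  ℕP.*-cancelʳ-≤ (P * suc N) (2 * (E * c)) 2 (subst (_≤ 2 * (E * c) * 2) (denominator P N) cross)
  where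
  D : ℕ
  D = N + 1 * suc N
  Ec/2N : ℚ
  Ec/2N = frac (E * c) D
  1+δ≤2 : (1ℚ ℚ.+ δ) ℚ.* Ec/2N ℚ.≤ frac 2 0 ℚ.* Ec/2N
  1+δ≤2 = ℚP.*-monoʳ-≤-nonNeg Ec/2N {{frac-nonNeg (E * c) D}} (ℚP.+-monoʳ-≤ 1ℚ δ≤1)
  doubled : frac P 1 ℚ.≤ frac (2 * (E * c)) (D + 0 * suc D)
  doubled = subst (frac P 1 ℚ.≤_) (frac-* 2 0 (E * c) D)
    (ℚP.≤-trans (subst (λ z → frac P 1 ℚ.≤ (1ℚ ℚ.+ δ) ℚ.* z) (frac-* E 1 c N) upper) 1+δ≤2)
  cross : P * suc (D + 0 * suc D) ≤ 2 * (E * c) * 2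
  cross = frac-≤⇒ P 1 (2 * (E * c)) (D + 0 * suc D) doubled
  denominator : ∀ P N → P * suc ((N + 1 * suc N) + 0 * suc (N + 1 * suc N)) ≡ P * suc N * 2
  denominator = solve-∀

C2 : ∀ k → (k C 2) * 2 ≡ k * (k ∸ 1)
C2 zero    = refl
C2 (suc k) = begin
  (suc k C 2) * 2           ≡⟨ cong (_* 2) (sym (nCk+nC[k+1]≡[n+1]C[k+1] k 1)) ⟩
  (k C 1 + (k C 2)) * 2       ≡⟨ cong (λ z → (z + (k C 2)) * 2) (nC1≡n k) ⟩
  (k + (k C 2)) * 2           ≡⟨ ℕP.*-distribʳ-+ 2 k (k C 2) ⟩
  k * 2 + (k C 2) * 2         ≡⟨ cong (_+_ (k * 2)) (C2 k) ⟩
  k * 2 + k * (k ∸ 1)       ≡⟨ pairs k ⟩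
  suc k * k                 ∎
  where
  open ≡-Reasoning
  pairs : ∀ k → k * 2 + k * (k ∸ 1) ≡ suc k * k
  pairs zero    = refl
  pairs (suc j) = pairs-suc j
    where
    pairs-suc : ∀ j → suc j * 2 + suc j * j ≡ suc (suc j) * suc j
    pairs-suc = solve-∀

C2-pos : ∀ k → 2 ≤ k → 0 < k C 2
C2-pos (suc zero) (s≤s ())
C2-pos (suc (suc j)) _ = subst (0 <_) (nCk+nC[k+1]≡[n+1]C[k+1] (suc j) 1)
  (ℕP.<-≤-trans (subst (0 <_) (sym (nC1≡n (suc j))) z<s) (ℕP.m≤m+n _ _))

-- If every one of b ≤ a "good" differences contributes u ordered pairs
-- (b·u ≤ P) while P·C(n,2) ≤ 2n·a·C(u,2), then b/a ≤ 2u/n.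
density-bound : ∀ {a b u n P} → 0 < n → 0 < u → b ≤ a → b * u ≤ P →
  P * (n C 2) ≤ 2 * (n * a * (u C 2)) → b * n ≤ 2 * a * u
density-bound {a} {b} {suc u₁} {suc n₁} {P} _ _ b≤a lower upper = begin
  b * suc n₁          ≡⟨ split b n₁ ⟩
  b * n₁ + b          ≤⟨ ℕP.+-mono-≤ cancelled (ℕP.≤-trans b≤a (ℕP.m≤n*m a 2)) ⟩
  2 * a * u₁ + 2 * a  ≡⟨ join a u₁ ⟩
  2 * a * suc u₁      ∎
  where
  open ℕP.≤-Reasoning
  n = suc n₁
  u = suc u₁
  split : ∀ b n₁ → b * suc n₁ ≡ b * n₁ + b
  split = solve-∀
  join : ∀ a u₁ → 2 * a * u₁ + 2 * a ≡ 2 * a * suc u₁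
  join = solve-∀
  regroup₁ : ∀ b u n n₁ → b * u * (n * n₁) ≡ (n * u) * (b * n₁)
  regroup₁ = solve-∀
  regroup₂ : ∀ n a c → 2 * (n * a * c) * 2 ≡ n * (2 * a * (c * 2))
  regroup₂ = solve-∀
  regroup₃ : ∀ n a u u₁ → n * (2 * a * (u * u₁)) ≡ (n * u) * (2 * a * u₁)
  regroup₃ = solve-∀
  scaled : (n * u) * (b * n₁) ≤ (n * u) * (2 * a * u₁)
  scaled = begin
    (n * u) * (b * n₁)          ≡⟨ sym (regroup₁ b u n n₁) ⟩
    b * u * (n * n₁)            ≡⟨ cong (b * u *_) (sym (C2 n)) ⟩
    b * u * ((n C 2) * 2)         ≤⟨ ℕP.*-monoˡ-≤ ((n C 2) * 2) lower ⟩
    P * ((n C 2) * 2)             ≡⟨ sym (ℕP.*-assoc P (n C 2) 2) ⟩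
    P * (n C 2) * 2             ≤⟨ ℕP.*-monoˡ-≤ 2 upper ⟩
    2 * (n * a * (u C 2)) * 2   ≡⟨ regroup₂ n a (u C 2) ⟩
    n * (2 * a * ((u C 2) * 2))   ≡⟨ cong (λ z → n * (2 * a * z)) (C2 u) ⟩
    n * (2 * a * (u * u₁))      ≡⟨ regroup₃ n a u u₁ ⟩
    (n * u) * (2 * a * u₁)      ∎
  cancelled : b * n₁ ≤ 2 * a * u₁
  cancelled = ℕP.*-cancelˡ-≤ (n * u) scaled

-- With n = mK and u = 2dK the density bound becomes m·b ≤ 4d·a.
cancel-kernel : ∀ a b m d K → 0 < K → b * (m * K) ≤ 2 * a * ((d + d) * K) → m * b ≤ 4 * d * a
cancel-kernel a b m d K K>0 bound = ℕP.*-cancelʳ-≤ (m * b) (4 * d * a) K {{ℕ.>-nonZero K>0}}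
  (subst₂ _≤_ (regroupˡ b m K) (regroupʳ a d K) bound)
  where
  regroupˡ : ∀ b m K → b * (m * K) ≡ m * b * K
  regroupˡ = solve-∀
  regroupʳ : ∀ a d K → 2 * a * ((d + d) * K) ≡ 4 * d * a * K
  regroupʳ = solve-∀

module GroupSums {n : ℕ} {_⊕_ : Fin n → Fin n → Fin n} {e : Fin n} {⊖_ : Fin n → Fin n}
                 (isGroup : IsGroup _≡_ _⊕_ e ⊖_) where

  group : Group 0ℓ 0ℓ
  group = record { Carrier = Fin n ; _≈_ = _≡_ ; _∙_ = _⊕_ ; ε = e ; _⁻¹ = ⊖_ ; isGroup = isGroup }

  open GroupProperties group using (⁻¹-involutive; //-rightDividesˡ; //-rightDividesʳ)

  ⊖-involutive : ∀ x → ⊖ (⊖ x) ≡ x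
  ⊖-involutive = ⁻¹-involutive

  ⊕-⊖-cancel : ∀ x y → (x ⊕ y) ⊕ (⊖ y) ≡ x
  ⊕-⊖-cancel x y = //-rightDividesʳ y x

  ⊖-⊕-cancel : ∀ x y → (x ⊕ (⊖ y)) ⊕ y ≡ x
  ⊖-⊕-cancel x y = //-rightDividesˡ y x

  sumFin-translate : ∀ (f : Fin n → ℕ) g → sumFin (λ x → f (x ⊕ g)) ≡ sumFin f
  sumFin-translate f g =
    sumFin-bijection f (_⊕ g) (_⊕ (⊖ g)) (λ x → ⊖-⊕-cancel x g) (λ x → ⊕-⊖-cancel x g)

  sumFin-invert : ∀ (f : Fin n → ℕ) → sumFin (λ x → f (⊖ x)) ≡ sumFin f
  sumFin-invert f = sumFin-bijection f ⊖_ ⊖_ ⊖-involutive ⊖-involutive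

module CayleyCounting {n : ℕ} {_⊕_ : Fin n → Fin n → Fin n} {e : Fin n} {⊖_ : Fin n → Fin n}
                      (isGroup : IsGroup _≡_ _⊕_ e ⊖_) (A : Fin n → Bool) where

  open GroupSums isGroup
  open Cayley _⊕_ ⊖_ A

  shiftOverlap : (Fin n → Bool) → Fin n → ℕ
  shiftOverlap U a = count (λ x → U x ∧ U (a ⊕ x))

  orderedPairs-by-difference : ∀ U → orderedPairs U ≡ sumFin (λ a → ι (A a) * shiftOverlap U a)
  orderedPairs-by-difference U = begin
    orderedPairs U
      ≡⟨ sumFin-cong (λ x → trans (ι-if (U x) (count (λ y → U y ∧ A (y ⊕ (⊖ x)))))
                                  (cong (ι (U x) *_) (neighbours x))) ⟩
    sumFin (λ x → ι (U x) * sumFin (λ a → ι (U (a ⊕ x) ∧ A a)))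
      ≡⟨ sumFin-cong (λ x → sym (sumFin-*ˡ (ι (U x)) (λ a → ι (U (a ⊕ x) ∧ A a)))) ⟩
    sumFin (λ x → sumFin (λ a → ι (U x) * ι (U (a ⊕ x) ∧ A a)))
      ≡⟨ sumFin-swap (λ x a → ι (U x) * ι (U (a ⊕ x) ∧ A a)) ⟩
    sumFin (λ a → sumFin (λ x → ι (U x) * ι (U (a ⊕ x) ∧ A a)))
      ≡⟨ sumFin-cong (λ a → trans (sumFin-cong (λ x → ι-exchange (U x) (U (a ⊕ x)) (A a)))
                                  (sumFin-*ˡ (ι (A a)) (λ x → ι (U x ∧ U (a ⊕ x))))) ⟩
    sumFin (λ a → ι (A a) * shiftOverlap U a)
      ∎
    where
    open ≡-Reasoning
    neighbours : ∀ x → count (λ y → U y ∧ A (y ⊕ (⊖ x))) ≡ sumFin (λ a → ι (U (a ⊕ x) ∧ A a))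
    neighbours x = trans (sym (sumFin-translate (λ y → ι (U y ∧ A (y ⊕ (⊖ x)))) x))
      (sumFin-cong (λ a → cong (λ z → ι (U (a ⊕ x) ∧ A z)) (⊕-⊖-cancel a x)))

  -- Every vertex has |A| neighbours, so 2e(G) = n|A|.
  orderedPairs-full : orderedPairs (λ _ → true) ≡ n * count A
  orderedPairs-full =
    trans (sumFin-cong (λ x → sumFin-translate (ι ∘ A) (⊖ x))) (sumFin-const {n} (count A))

  disc-upper : ∀ {δ} → δ ℚ.≤ 1ℚ → DISC δ → 2 ≤ n → ∀ U → δ ℚ.* ℕ→ℚ n ℚ.≤ ℕ→ℚ (count U) →
    orderedPairs U * (n C 2) ≤ 2 * (n * count A * (count U C 2))
  disc-upper {δ} δ≤1 disc 2≤n U large =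
    halves-bound δ δ≤1 (orderedPairs U) (n * count A) (count U C 2) (n C 2) (C2-pos n 2≤n)
      (subst (λ E → edgesIn U ℚ.≤ (1ℚ ℚ.+ δ) ℚ.* (ratio E 2 ℚ.* ratio (count U C 2) (n C 2)))
             orderedPairs-full (proj₂ (disc U large)))

module Residues {n : ℕ} {_⊕_ : Fin n → Fin n → Fin n} {e : Fin n} {⊖_ : Fin n → Fin n}
                (isGroup : IsGroup _≡_ _⊕_ e ⊖_)
                (m : ℕ) .{{_ : NonZero m}} (ρ : Fin n → Fin m) (hom : IsHomToZmod _⊕_ m ρ)
                (surj : ∀ (s : Fin m) → ∃ λ γ → ρ γ ≡ s) where

  open GroupSums isGroup
  open IsGroup isGroup using (identityˡ; inverseʳ)

  r : Fin n → ℕ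
  r x = toℕ (ρ x)

  r<m : ∀ x → r x < m
  r<m x = FinP.toℕ<n (ρ x)

  r-hom : ∀ x y → r (x ⊕ y) ≡ (r x + r y) % m
  r-hom x y = trans (cong toℕ (hom x y)) (FinP.toℕ-fromℕ< _)

  r-identity : r e ≡ 0
  r-identity = %-cancel (r<m e) (r<m e) (trans (sym (r-hom e e)) (cong r (identityˡ e)))

  r-sum-inverse : ∀ a → (r a + r (⊖ a)) % m ≡ 0
  r-sum-inverse a = trans (sym (r-hom a (⊖ a))) (trans (cong r (inverseʳ a)) r-identity)

  r-inverse : ∀ a → 0 < r a → r (⊖ a) ≡ m ∸ r a
  r-inverse a 0<ra = %-complement 0<ra (r<m a) (r<m (⊖ a)) (r-sum-inverse a)

  r-translate-kernel : ∀ a x → r a ≡ 0 → r (a ⊕ x) ≡ r x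
  r-translate-kernel a x ra≡0 =
    trans (r-hom a x) (trans (cong (λ z → (z + r x) % m) ra≡0) (m<n⇒m%n≡m (r<m x)))

  r-inverse-kernel : ∀ a → r a ≡ 0 → r (⊖ a) ≡ 0
  r-inverse-kernel a ra≡0 =
    trans (sym (r-translate-kernel a (⊖ a) ra≡0)) (trans (cong r (inverseʳ a)) r-identity)

  fibre : ℕ → ℕ
  fibre s = count (λ x → r x ≡ᵇ s)

  K : ℕ
  K = fibre 0

  -- Since ρ is onto, every fibre is a translate of the kernel.
  fibre-size : ∀ s → s < m → fibre s ≡ K
  fibre-size s s<m = trans (sym (sumFin-translate (λ x → ι (r x ≡ᵇ s)) γ)) (sumFin-cong shifted)
    where
    γ : Fin n
    γ = proj₁ (surj (fromℕ< s<m))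
    rγ≡s : r γ ≡ s
    rγ≡s = trans (cong toℕ (proj₂ (surj (fromℕ< s<m)))) (FinP.toℕ-fromℕ< s<m)
    shifted : ∀ x → ι (r (x ⊕ γ) ≡ᵇ s) ≡ ι (r x ≡ᵇ 0)
    shifted x = cong ι (trans (cong (_≡ᵇ s) (trans (r-hom x γ) (cong (λ z → (r x + z) % m) rγ≡s)))
                              (%-shift-≡ᵇ (r<m x) s<m))

  count-below : ∀ k → k ≤ m → count (λ x → r x <ᵇ k) ≡ k * K
  count-below zero    _   = trans (sumFin-const {n} 0) (ℕP.*-zeroʳ n)
  count-below (suc k) k<m = begin
    count (λ x → r x <ᵇ suc k)                  ≡⟨ sumFin-cong (λ x → ι-<ᵇ-suc (r x) k) ⟩
    sumFin (λ x → ι (r x <ᵇ k) + ι (r x ≡ᵇ k))  ≡⟨ sumFin-+ (λ x → ι (r x <ᵇ k)) (λ x → ι (r x ≡ᵇ k)) ⟩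
    count (λ x → r x <ᵇ k) + fibre k            ≡⟨ cong₂ _+_ (count-below k (ℕP.<⇒≤ k<m)) (fibre-size k k<m) ⟩
    k * K + K                                   ≡⟨ ℕP.+-comm (k * K) K ⟩
    suc k * K                                   ∎
    where open ≡-Reasoning

  order : n ≡ m * K
  order = begin
    n                       ≡⟨ sym (ℕP.*-identityʳ n) ⟩
    n * 1                   ≡⟨ sym (sumFin-const {n} 1) ⟩
    sumFin {n} (λ _ → 1)    ≡⟨ sumFin-cong (λ x → sym (ι-<ᵇ (r<m x))) ⟩
    count (λ x → r x <ᵇ m)  ≡⟨ count-below m ℕP.≤-refl ⟩
    m * K                   ∎
    where open ≡-Reasoning

  K>0 : 0 < n → 0 < K
  K>0 0<n = ℕP.n≢0⇒n>0 (λ K≡0 →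
    ℕP.<⇒≢ 0<n (sym (trans order (trans (cong (m *_) K≡0) (ℕP.*-zeroʳ m)))))

  module Window (A : Fin n → Bool) (A-sym : ∀ x → A x ≡ true → A (⊖ x) ≡ true)
                (d : ℕ) (2d≤m : d + d ≤ m) where

    open CayleyCounting isGroup A
    open Cayley _⊕_ ⊖_ A using (orderedPairs)

    U B C : Fin n → Bool
    U x = r x <ᵇ d + d
    B x = r x <ᵇ d
    C x = B x ∧ not (r x ≡ᵇ 0)

    A-⊖ : ∀ a → A (⊖ a) ≡ A a
    A-⊖ a with A a in Aa | A (⊖ a) in A⊖a
    ... | true  | true  = refl
    ... | false | false = refl
    ... | true  | false = trans (sym A⊖a) (A-sym a Aa)
    ... | false | true  = trans (sym (A-sym (⊖ a) A⊖a)) (trans (cong A (⊖-involutive a)) Aa)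

    -- Residues of a and ⊖a add up to 0 mod m, so both are < d only if both vanish.
    short-inverse : ∀ a → r a < d → r (⊖ a) < d → r (⊖ a) ≡ 0
    short-inverse a ra<d r⊖a<d with r a ℕP.≟ 0
    ... | yes ra≡0 = r-inverse-kernel a ra≡0
    ... | no  ra≢0 = ⊥-elim (ℕP.<⇒≱ m<2d 2d≤m)
      where
      m<2d : m < d + d
      m<2d = subst (_< d + d) (ℕP.m∸n+n≡m (ℕP.<⇒≤ (r<m a)))
        (ℕP.+-mono-< (subst (_< d) (r-inverse a (ℕP.n≢0⇒n>0 ra≢0)) r⊖a<d) ra<d)

    B-C-disjoint : ∀ a → ι (B a) + ι (C (⊖ a)) ≤ 1
    B-C-disjoint a with r a <ᵇ d in ra<d | r (⊖ a) <ᵇ d in r⊖a<d | r (⊖ a) ≡ᵇ 0 in r⊖a≡0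
    ... | false | b    | z     = ι≤1 (b ∧ not z)
    ... | true  | false | _    = ℕP.≤-refl
    ... | true  | true  | true = ℕP.≤-refl
    ... | true  | true  | false
      with () ← trans (sym r⊖a≡0) (T⇒≡true (ℕP.≡⇒≡ᵇ _ 0
                  (short-inverse a (ℕP.<ᵇ⇒< _ _ (≡true⇒T ra<d)) (ℕP.<ᵇ⇒< _ _ (≡true⇒T r⊖a<d)))))

    -- Translating the window by a residue in [0, d): a kernel element keeps it
    -- fixed; otherwise each point of U stays in U under a or under ⊖a.
    window-cover : ∀ a → r a < d →
      count U ≤ shiftOverlap U a + ι (not (r a ≡ᵇ 0)) * shiftOverlap U (⊖ a)
    window-cover a ra<d with r a ≡ᵇ 0 in ra≡ᵇ0
    ... | true = ℕP.≤-trans (sumFin-mono kept) (ℕP.m≤m+n (shiftOverlap U a) 0)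
      where
      same : ∀ x → r (a ⊕ x) ≡ r x
      same x = r-translate-kernel a x (ℕP.≡ᵇ⇒≡ _ 0 (≡true⇒T ra≡ᵇ0))
      kept : ∀ x → ι (U x) ≤ ι (U x ∧ U (a ⊕ x))
      kept x = ℕP.≤-reflexive (cong ι (sym
        (trans (cong (λ y → U x ∧ (y <ᵇ d + d)) (same x)) (∧-idem (U x)))))
    ... | false = begin
      count U
        ≤⟨ sumFin-mono covered ⟩
      sumFin (λ x → ι (U x ∧ U (a ⊕ x)) + ι (U x ∧ U ((⊖ a) ⊕ x)))
        ≡⟨ sumFin-+ (λ x → ι (U x ∧ U (a ⊕ x))) (λ x → ι (U x ∧ U ((⊖ a) ⊕ x))) ⟩
      shiftOverlap U a + shiftOverlap U (⊖ a)
        ≡⟨ cong (_+_ (shiftOverlap U a)) (sym (ℕP.*-identityˡ (shiftOverlap U (⊖ a)))) ⟩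
      shiftOverlap U a + 1 * shiftOverlap U (⊖ a)
        ∎
      where
      open ℕP.≤-Reasoning
      0<ra : 0 < r a
      0<ra = ≢ᵇ0⇒>0 ra≡ᵇ0
      covered : ∀ x → ι (U x) ≤ ι (U x ∧ U (a ⊕ x)) + ι (U x ∧ U ((⊖ a) ⊕ x))
      covered x with r x <ᵇ d + d in x∈U
      ... | false = z≤n
      ... | true with %-window ra<d 2d≤m (ℕP.<ᵇ⇒< _ _ (≡true⇒T x∈U))
      ...   | inj₁ up   = ℕP.≤-trans (ℕP.≤-reflexive (sym (ι-<ᵇ (subst (_< d + d) (sym (r-hom a x)) up))))
                                     (ℕP.m≤m+n _ _)
      ...   | inj₂ down = ℕP.≤-trans (ℕP.≤-reflexive (sym (ι-<ᵇ (subst (_< d + d) (sym r⊖a⊕x) down))))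
                                     (ℕP.m≤n+m _ _)
        where
        r⊖a⊕x : r ((⊖ a) ⊕ x) ≡ ((m ∸ r a) + r x) % m
        r⊖a⊕x = trans (r-hom (⊖ a) x) (cong (λ z → (z + r x) % m) (r-inverse a 0<ra))

    -- Each a ∈ B contributes |U|; a nonzero residue shares it with ⊖a.
    weighted-cover : ∀ a →
      ι (B a) * count U ≤ ι (B a) * shiftOverlap U a + ι (C a) * shiftOverlap U (⊖ a)
    weighted-cover a with r a <ᵇ d in ra<d
    ... | false = z≤n
    ... | true  = subst₂ _≤_ (sym (ℕP.*-identityˡ (count U)))
      (cong (_+ ι (not (r a ≡ᵇ 0)) * shiftOverlap U (⊖ a)) (sym (ℕP.*-identityˡ (shiftOverlap U a))))
      (window-cover a (ℕP.<ᵇ⇒< _ _ (≡true⇒T ra<d)))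

    pairs-lower : count (λ a → A a ∧ B a) * count U ≤ orderedPairs U
    pairs-lower = begin
      count (λ a → A a ∧ B a) * count U
        ≡⟨ sym (sumFin-*ʳ (count U) (λ a → ι (A a ∧ B a))) ⟩
      sumFin (λ a → ι (A a ∧ B a) * count U)
        ≡⟨ sumFin-cong (λ a → ι-∧-* (A a) (B a) (count U)) ⟩
      sumFin (λ a → ι (A a) * (ι (B a) * count U))
        ≤⟨ sumFin-mono (λ a → ℕP.*-monoʳ-≤ (ι (A a)) (weighted-cover a)) ⟩
      sumFin (λ a → ι (A a) * (ι (B a) * F a + ι (C a) * F (⊖ a)))
        ≡⟨ sumFin-cong (λ a → ℕP.*-distribˡ-+ (ι (A a)) (ι (B a) * F a) (ι (C a) * F (⊖ a))) ⟩
      sumFin (λ a → ι (A a) * (ι (B a) * F a) + ι (A a) * (ι (C a) * F (⊖ a)))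
        ≡⟨ sumFin-+ onB onC ⟩
      sumFin onB + sumFin onC
        ≡⟨ cong (_+_ (sumFin onB)) inverse-shares ⟩
      sumFin onB + sumFin onC⊖
        ≡⟨ sym (sumFin-+ onB onC⊖) ⟩
      sumFin (λ a → onB a + onC⊖ a)
        ≤⟨ sumFin-mono disjoint-shares ⟩
      sumFin (λ a → ι (A a) * F a)
        ≡⟨ sym (orderedPairs-by-difference U) ⟩
      orderedPairs U
        ∎
      where
      open ℕP.≤-Reasoning
      F : Fin n → ℕ
      F = shiftOverlap U
      onB onC onC⊖ : Fin n → ℕ
      onB a  = ι (A a) * (ι (B a) * F a)
      onC a  = ι (A a) * (ι (C a) * F (⊖ a))
      onC⊖ a = ι (A a) * (ι (C (⊖ a)) * F a)
      -- reindex the shares of C by a ↦ ⊖a, using that A is symmetric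
      inverse-shares : sumFin onC ≡ sumFin onC⊖
      inverse-shares = trans
        (sumFin-cong (λ a → cong₂ (λ p y → ι p * (ι (C y) * F (⊖ a))) (sym (A-⊖ a)) (sym (⊖-involutive a))))
        (sumFin-invert onC⊖)
      regroup : ∀ p q c w → p * (q * w) + p * (c * w) ≡ p * ((q + c) * w)
      regroup = solve-∀
      disjoint-shares : ∀ a → onB a + onC⊖ a ≤ ι (A a) * F a
      disjoint-shares a = begin
        onB a + onC⊖ a                              ≡⟨ regroup (ι (A a)) (ι (B a)) (ι (C (⊖ a))) (F a) ⟩
        ι (A a) * ((ι (B a) + ι (C (⊖ a))) * F a)   ≤⟨ ℕP.*-monoʳ-≤ (ι (A a)) (ℕP.*-monoˡ-≤ (F a) (B-C-disjoint a)) ⟩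
        ι (A a) * (1 * F a)                         ≡⟨ cong (ι (A a) *_) (ℕP.*-identityˡ (F a)) ⟩
        ι (A a) * F a                               ∎

-- The main case of Lemma A.13: 0 < d and 2d ≤ m (it only needs 2 ≤ |Γ|, δ ≤ 1
-- and a group, not commutativity).
short-arc-bound : ∀ {n} {_⊕_ : Fin n → Fin n → Fin n} {e : Fin n} {⊖_ : Fin n → Fin n} →
  IsGroup _≡_ _⊕_ e ⊖_ → 2 ≤ n →
  (A : Fin n → Bool) → (∀ x → A x ≡ true → A (⊖ x) ≡ true) →
  (m : ℕ) .{{_ : NonZero m}} (ρ : Fin n → Fin m) → IsHomToZmod _⊕_ m ρ →
  (∀ (s : Fin m) → ∃ λ γ → ρ γ ≡ s) →
  (δ : ℚ) → δ ℚ.≤ 1ℚ → (d : ℕ) → 0 < d → d + d ≤ m → δ ℚ.* ℕ→ℚ m ℚ.* ½ ℚ.≤ ℕ→ℚ d →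
  Cayley.DISC _⊕_ ⊖_ A δ →
  m * count (λ γ → A γ ∧ (toℕ (ρ γ) <ᵇ d)) ≤ 4 * d * count A
short-arc-bound {n} isGroup 2≤n A A-sym m ρ hom surj δ δ≤1 d 0<d 2d≤m δm/2≤d disc =
  cancel-kernel (count A) b m d K (K>0 0<n)
    (subst₂ (λ n′ u′ → b * n′ ≤ 2 * count A * u′) order |U| density)
  where
  open Residues isGroup m ρ hom surj
  open Window A A-sym d 2d≤m
  open CayleyCounting isGroup A using (disc-upper)
  0<n : 0 < n
  0<n = ℕP.<-≤-trans z<s 2≤n
  b : ℕ
  b = count (λ a → A a ∧ B a)
  |U| : count U ≡ (d + d) * K
  |U| = count-below (d + d) 2d≤m
  large : δ ℚ.* ℕ→ℚ n ℚ.≤ ℕ→ℚ (count U)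
  large = subst₂ (λ n′ u′ → δ ℚ.* ℕ→ℚ n′ ℚ.≤ ℕ→ℚ u′) (sym order) (sym |U|) (window-large δ m d K δm/2≤d)
  density : b * n ≤ 2 * count A * count U
  density = density-bound 0<n
    (subst (0 <_) (sym |U|) (ℕP.*-mono-< (ℕP.<-≤-trans 0<d (ℕP.m≤m+n d d)) (K>0 0<n))) (count-∧≤ A B) pairs-lower (disc-upper δ≤1 disc 2≤n U large)

lemmaA13 : (n : ℕ) → 4 ≤ n →
    (_⊕_ : Fin n → Fin n → Fin n) (e : Fin n) (⊖_ : Fin n → Fin n) →
    IsAbelianGroup _≡_ _⊕_ e ⊖_ →
    (A : Fin n → Bool) → A e ≡ false → (∀ x → A x ≡ true → A (⊖ x) ≡ true) →
    (m : ℕ) .{{_ : NonZero m}} → 2 ≤ m →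
    (ρ : Fin n → Fin m) → IsHomToZmod _⊕_ m ρ → (∀ (r : Fin m) → ∃ λ γ → ρ γ ≡ r) →
    (δ : ℚ) → 0ℚ ℚ.< δ → δ ℚ.≤ (+ 1 / 3) →
    (d : ℕ) → δ ℚ.* ℕ→ℚ m ℚ.* ½ ℚ.≤ ℕ→ℚ d →
    Cayley.DISC _⊕_ ⊖_ A δ →
    m * count (λ γ → A γ ∧ (toℕ (ρ γ) <ᵇ d)) ≤ 4 * d * count A
lemmaA13 n 4≤n _⊕_ e ⊖_ G A _ A-sym m _ ρ hom surj δ _ δ≤⅓ d δm/2≤d disc with m ≤? 4 * d | d ℕP.≟ 0
-- m ≤ 4d: trivial, as |A ∩ ρ⁻¹[0,d)| ≤ |A|.
... | yes m≤4d | _        = ℕP.*-mono-≤ m≤4d (count-∧≤ A (λ γ → toℕ (ρ γ) <ᵇ d))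
-- d = 0: no residue lies in [0, 0).
... | no _     | yes refl = ℕP.≤-reflexive (trans (cong (m *_) (count-∧-false A)) (ℕP.*-zeroʳ m))
... | no m≰4d  | no d≢0   = short-arc-bound (IsAbelianGroup.isGroup G) (ℕP.≤-trans (s≤s (s≤s z≤n)) 4≤n)
  A A-sym m ρ hom surj δ (ℚP.≤-trans δ≤⅓ ⅓≤1) d (ℕP.n≢0⇒n>0 d≢0)
  (ℕP.≤-trans (ℕP.+-monoʳ-≤ d (ℕP.m≤m+n d (d + (d + 0)))) (ℕP.<⇒≤ (ℕP.≰⇒> m≰4d))) δm/2≤d disc
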